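{- Let $q$ be an odd prime power, $\alpha,\beta\in\mathbb F_q^*$ and $\gamma\in\mathbb F_q$. Then $M_{\alpha,\beta,\gamma}(S)=M_{1,\beta,\alpha\gamma}(S)$.
   Context: Let $q=p^e$, $\zeta=e^{2\pi i/p}$, $tr(a)=a+a^p+\cdots+a^{p^{e-1}}$ the trace $\mathbb F_q\to\mathbb F_p$. Let $G=(\mathbb F_q^5,\cdot)$ with $X\cdot Y=(x_1+y_1,x_2+y_2,x_3+y_3,x_4+y_4+2x_1y_2,x_5+y_5+2x_1y_3)$ and $S=\{(x,xa,xa^2,x^2a,x^2a^2):a,x\in\mathbb F_q,x\ne0\}$. For $\alpha\in\mathbb F_q^*$, $\beta,\gamma\in\mathbb F_q$ and $X\in G$, $M_{\alpha,\beta,\gamma}(X)$ is the $q\times q$ matrix with rows and columns indexed by $\mathbb F_q$ whose $(j,k)$ entry is $\zeta^{tr\left((x_2+\frac{\beta}{\alpha}x_3)j+\alpha x_4+\beta x_5+\gamma x_3\right)}$ if $k=2\alpha x_1+j$ and $0$ otherwise; and $M_{\alpha,\beta,\gamma}(S)=\sum_{g\in S}M_{\alpha,\beta,\gamma}(g)$. -}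

module Defs where

open import Level using (0ℓ)
open import Data.Nat as ℕ using (ℕ; zero; suc)
open import Data.Nat.Primality using (Prime)
open import Data.Integer as ℤ using (ℤ)
open import Data.Fin using (Fin; toℕ)
open import Data.Product using (Σ; _×_; _,_; ∃)
open import Data.Product.Properties using (≡-dec)
open import Data.List using (List; []; _∷_; foldr; filter; map; cartesianProduct; length)
open import Data.List.Membership.Propositional using (_∈_)
open import Data.List.Relation.Unary.Unique.Propositional using (Unique)
open import Data.List.Relation.Unary.Any using (Any; any?)
open import Relation.Binary.PropositionalEquality using (_≡_; _≢_)
open import Relation.Binary.Definitions using (DecidableEquality)
open import Relation.Nullary using (¬_; yes; no)
open import Relation.Nullary.Decidable using (¬?; _×-dec_)
open import Algebra.Structures using (IsCommutativeRing)

natMul : {A : Set} → (A → A → A) → A → A → ℕ → A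
natMul _+_ 0# 1# zero = 0#
natMul _+_ 0# 1# (suc n) = 1# + natMul _+_ 0# 1# n

record FiniteField : Set₁ where
  field
    Carrier : Set
    _+_ _*_ : Carrier → Carrier → Carrier
    -_ : Carrier → Carrier
    0# 1# : Carrier
    isCommutativeRing : IsCommutativeRing _≡_ _+_ _*_ -_ 0# 1#
    _⁻¹ : Carrier → Carrier
    ⁻¹-inverse : ∀ x → x ≢ 0# → x * (x ⁻¹) ≡ 1#
    0≢1 : 0# ≢ 1#
    _≟_ : DecidableEquality Carrier
    elems : List Carrier
    elems-complete : ∀ x → x ∈ elems
    elems-unique : Unique elems
    p e : ℕ
    p-prime : Prime p
    cardinality : length elems ≡ p ℕ.^ e

    characteristic : natMul _+_ 0# 1# p ≡ 0#

  infixl 6 _+_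
  infixl 7 _*_

  fromℕ : ℕ → Carrier
  fromℕ = natMul _+_ 0# 1#

  q : ℕ
  q = p ℕ.^ e

  _^_ : Carrier → ℕ → Carrier
  x ^ zero = 1#
  x ^ suc n = x * (x ^ n)

  trace : Carrier → Carrier
  trace a = go e
    where
    go : ℕ → Carrier
    go zero = 0#
    go (suc i) = go i + a ^ (p ℕ.^ i)

  _/_ : Carrier → Carrier → Carrier
  x / y = x * (y ⁻¹)

  2# : Carrier
  2# = 1# + 1#

-- The ring Z[ζ], ζ = e^(2πi/p), as the group ring Z[C_p] (functions
-- Fin p → ℤ, the coefficient of ζ^t) modulo the ideal generated by
-- 1 + ζ + ... + ζ^(p-1), i.e. modulo constant vectors.

Zζ : ℕ → Set
Zζ p = Fin p → ℤ

module _ {p : ℕ} where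
  0ζ : Zζ p
  0ζ _ = ℤ.0ℤ

  _⊕_ : Zζ p → Zζ p → Zζ p
  (u ⊕ v) t = u t ℤ.+ v t

  _≈ζ_ : Zζ p → Zζ p → Set
  u ≈ζ v = ∃ λ (c : ℤ) → ∀ t → u t ≡ v t ℤ.+ c

  sumζ : List (Zζ p) → Zζ p
  sumζ = foldr _⊕_ 0ζ

module Matrices (F : FiniteField) where
  open FiniteField F

  -- ζ^a for a in the prime field F_p ⊆ F : the basis vector at the
  -- t ∈ Fin p with t·1 = a.
  ζ^ : Carrier → Zζ p
  ζ^ a t with fromℕ (toℕ t) ≟ a
  ... | yes _ = ℤ.1ℤ
  ... | no _ = ℤ.0ℤ

  G : Set
  G = Carrier × Carrier × Carrier × Carrier × Carrier

  _≟G_ : DecidableEquality G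
  _≟G_ = ≡-dec _≟_ (≡-dec _≟_ (≡-dec _≟_ (≡-dec _≟_ _≟_)))

  elemsG : List G
  elemsG = cartesianProduct elems (cartesianProduct elems
             (cartesianProduct elems (cartesianProduct elems elems)))

  sPoint : Carrier → Carrier → G
  sPoint a x = (x , x * a , x * (a * a) , (x * x) * a , (x * x) * (a * a))

  -- membership in S = {(x,xa,xa²,x²a,x²a²) : a,x ∈ F_q, x ≠ 0}
  -- (existentials range over the exhaustive enumeration elems)
  InS : G → Set
  InS g = Any (λ a → Any (λ x → x ≢ 0# × g ≡ sPoint a x) elems) elems

  InS? : ∀ g → Relation.Nullary.Dec (InS g)
  InS? g = any? (λ a → any? (λ x → ¬? (x ≟ 0#) ×-dec (g ≟G sPoint a x)) elems) elems

  S : List G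
  S = filter InS? elemsG

  Matrix : Set
  Matrix = Carrier → Carrier → Zζ p

  M : Carrier → Carrier → Carrier → G → Matrix
  M α β γ (x₁ , x₂ , x₃ , x₄ , x₅) j k with k ≟ (2# * α * x₁ + j)
  ... | yes _ = ζ^ (trace ((x₂ + (β / α) * x₃) * j + α * x₄ + β * x₅ + γ * x₃))
  ... | no _ = 0ζ

  MS : Carrier → Carrier → Carrier → Matrix
  MS α β γ j k = sumζ (map (λ g → M α β γ g j k) S)

{-# OPTIONS --safe #-}
-- Reparametrising S by (a , x) ↦ (a / α , α x) permutes S and is induced by
-- ψ (x₁ , x₂ , x₃ , x₄ , x₅) = (α x₁ , x₂ , x₃ / α , α x₄ , x₅).  Under ψ each
-- summand of M_{α,β,γ}(S) becomes the corresponding summand of M_{1,β,αγ}(S):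
-- the column shift 2αx₁ is unchanged, and so is the phase, since
-- (β/α) x₃ = β (x₃/α) and γ x₃ = (αγ)(x₃/α).
module Submission where

open import Defs
open import Data.Nat.Divisibility using (_∣_)
open import Relation.Nullary using (¬_)
open import Relation.Binary.PropositionalEquality using (_≢_)

open import Algebra.Bundles using (CommutativeRing)
import Algebra.Construct.Pointwise as Pointwise
open import Algebra.Structures using (IsCommutativeRing; IsCommutativeMonoid)
open import Data.Empty using (⊥-elim)
open import Data.Fin using (Fin)
import Data.Integer as ℤ
import Data.Integer.Properties as ℤ
open import Data.List using (List; map)
import Data.List.Properties as List
open import Data.List.Membership.Propositional using (_∈_; lose)
open import Data.List.Membership.Propositional.Properties
  using (∈-map⁺; ∈-map⁻; ∈-filter⁺; ∈-filter⁻; ∈-cartesianProduct⁺)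
open import Data.List.Membership.Propositional.Properties.WithK using (unique∧set⇒bag)
open import Data.List.Relation.Binary.BagAndSetEquality using (∼bag⇒↭)
open import Data.List.Relation.Binary.Permutation.Propositional using (_↭_; ↭⇒↭ₛ′)
import Data.List.Relation.Binary.Permutation.Propositional.Properties as ↭
import Data.List.Relation.Binary.Permutation.Setoid.Properties as ↭ₛ
open import Data.List.Relation.Unary.Any using (satisfied)
open import Data.List.Relation.Unary.Unique.Propositional using (Unique)
import Data.List.Relation.Unary.Unique.Propositional.Properties as Unique
open import Data.Product using (_,_; _×_; proj₂; ∃₂)
open import Function using (_∘_; _⇔_; mk⇔)
open import Relation.Nullary using (yes; no)
open import Relation.Binary.Bundles using (Setoid)
open import Relation.Binary.Structures using (IsEquivalence)
open import Relation.Binary.PropositionalEquality as ≡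
  using (_≡_; refl; cong; cong₂; sym; trans; subst; module ≡-Reasoning)

unique-⇔⇒↭ : ∀ {A : Set} {xs ys : List A} → Unique xs → Unique ys →
             (∀ {z} → z ∈ xs ⇔ z ∈ ys) → xs ↭ ys
unique-⇔⇒↭ xs! ys! xs⇔ys = ∼bag⇒↭ (unique∧set⇒bag xs! ys! xs⇔ys)

sumζ-↭ : ∀ {p} {us vs : List (Zζ p)} → us ↭ vs → ∀ t → sumζ us t ≡ sumζ vs t
sumζ-↭ {p} us↭vs = foldr-commMonoid +-isCommutativeMonoid (↭⇒↭ₛ′ pointwise-≡ us↭vs)
  where
  pointwise-≡ : IsEquivalence {A = Zζ p} (λ u v → ∀ t → u t ≡ v t)
  pointwise-≡ = Pointwise.isEquivalence (Fin p) ≡.isEquivalence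
  +-isCommutativeMonoid : IsCommutativeMonoid (λ u v → ∀ t → u t ≡ v t) _⊕_ 0ζ
  +-isCommutativeMonoid = Pointwise.isCommutativeMonoid (Fin p) ℤ.+-0-isCommutativeMonoid
  pointwise-setoid : Setoid _ _
  pointwise-setoid = record { isEquivalence = pointwise-≡ }
  open ↭ₛ pointwise-setoid using (foldr-commMonoid)

sumζ-reindex : ∀ {p} {A B : Set} (f : B → Zζ p) (g : A → B) {xs : List A} {ys : List B} →
               map g xs ↭ ys → ∀ t → sumζ (map (f ∘ g) xs) t ≡ sumζ (map f ys) t
sumζ-reindex f g {xs} {ys} gxs↭ys t = begin
  sumζ (map (f ∘ g) xs) t   ≡⟨ cong (λ us → sumζ us t) (List.map-∘ xs) ⟩
  sumζ (map f (map g xs)) t ≡⟨ sumζ-↭ (↭.map⁺ f gxs↭ys) t ⟩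
  sumζ (map f ys) t         ∎
  where open ≡-Reasoning

module _ (F : FiniteField) where
  open FiniteField F
  open Matrices F
  open IsCommutativeRing isCommutativeRing using (*-identityˡ)

  1⁻¹≡1 : 1# ⁻¹ ≡ 1#
  1⁻¹≡1 = trans (sym (*-identityˡ _)) (⁻¹-inverse 1# (0≢1 ∘ sym))

  ∈elemsG : ∀ g → g ∈ elemsG
  ∈elemsG (a , b , c , d , e) = ∈-cartesianProduct⁺ (elems-complete a)
    (∈-cartesianProduct⁺ (elems-complete b) (∈-cartesianProduct⁺ (elems-complete c)
      (∈-cartesianProduct⁺ (elems-complete d) (elems-complete e))))

  sPoint∈S : ∀ a {x} → x ≢ 0# → sPoint a x ∈ S
  sPoint∈S a {x} x≢0 = ∈-filter⁺ InS? (∈elemsG _)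
    (lose (elems-complete a) (lose (elems-complete x) (x≢0 , refl)))

  ∈S⇒sPoint : ∀ {g} → g ∈ S → ∃₂ λ a x → x ≢ 0# × g ≡ sPoint a x
  ∈S⇒sPoint g∈S with satisfied (proj₂ (∈-filter⁻ InS? {xs = elemsG} g∈S))
  ... | a , ∃x with satisfied ∃x
  ... | x , x≢0 , g≡ = a , x , x≢0 , g≡

  S-unique : Unique S
  S-unique = Unique.filter⁺ InS? (Unique.cartesianProduct⁺ elems-unique
    (Unique.cartesianProduct⁺ elems-unique (Unique.cartesianProduct⁺ elems-unique
      (Unique.cartesianProduct⁺ elems-unique elems-unique))))

module Rescaling (F : FiniteField) {α : FiniteField.Carrier F} (α≢0 : α ≢ FiniteField.0# F) where
  open FiniteField F
  open Matrices F
  open IsCommutativeRing isCommutativeRing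
    using (*-assoc; *-identityˡ; *-identityʳ; zeroʳ)

  commutativeRing : CommutativeRing _ _
  commutativeRing = record { isCommutativeRing = isCommutativeRing }

  open import Algebra.Solver.Ring.NaturalCoefficients.Default
    (CommutativeRing.commutativeSemiring commutativeRing)

  α*α⁻¹≡1 : α * α ⁻¹ ≡ 1#
  α*α⁻¹≡1 = ⁻¹-inverse α α≢0

  -- The ring solver treats α ⁻¹ as an independent variable, so identities
  -- involving it are solved with an explicit factor α * α ⁻¹, removed here.
  cancel-α*α⁻¹ : ∀ {x y} → x ≡ (α * α ⁻¹) * y → x ≡ y
  cancel-α*α⁻¹ {y = y} x≡ = trans x≡ (trans (cong (_* y) α*α⁻¹≡1) (*-identityˡ y))

  α*[α⁻¹*x] : ∀ x → α * (α ⁻¹ * x) ≡ x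
  α*[α⁻¹*x] x = cancel-α*α⁻¹ (sym (*-assoc α (α ⁻¹) x))

  α⁻¹*[α*x] : ∀ x → α ⁻¹ * (α * x) ≡ x
  α⁻¹*[α*x] x = cancel-α*α⁻¹ (solve 3 (λ a b y → b :* (a :* y) := (a :* b) :* y) refl α (α ⁻¹) x)

  α*[x*α⁻¹] : ∀ x → α * (x * α ⁻¹) ≡ x
  α*[x*α⁻¹] x = cancel-α*α⁻¹ (solve 3 (λ a b y → a :* (y :* b) := (a :* b) :* y) refl α (α ⁻¹) x)

  [x*α]*α⁻¹ : ∀ x → (x * α) * α ⁻¹ ≡ x
  [x*α]*α⁻¹ x = cancel-α*α⁻¹ (solve 3 (λ a b y → (y :* a) :* b := (a :* b) :* y) refl α (α ⁻¹) x)

  α*x≢0 : ∀ {x} → x ≢ 0# → α * x ≢ 0#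
  α*x≢0 {x} x≢0 αx≡0 = x≢0 (trans (sym (α⁻¹*[α*x] x)) (trans (cong (α ⁻¹ *_) αx≡0) (zeroʳ _)))

  α⁻¹*x≢0 : ∀ {x} → x ≢ 0# → α ⁻¹ * x ≢ 0#
  α⁻¹*x≢0 {x} x≢0 α⁻¹x≡0 = x≢0 (trans (sym (α*[α⁻¹*x] x)) (trans (cong (α *_) α⁻¹x≡0) (zeroʳ _)))

  rescale : G → G
  rescale (x₁ , x₂ , x₃ , x₄ , x₅) = (α * x₁ , x₂ , x₃ * α ⁻¹ , α * x₄ , x₅)

  unscale : G → G
  unscale (x₁ , x₂ , x₃ , x₄ , x₅) = (α ⁻¹ * x₁ , x₂ , α * x₃ , α ⁻¹ * x₄ , x₅)

  unscale∘rescale : ∀ g → unscale (rescale g) ≡ g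
  unscale∘rescale (x₁ , x₂ , x₃ , x₄ , x₅)
    rewrite α⁻¹*[α*x] x₁ | α*[x*α⁻¹] x₃ | α⁻¹*[α*x] x₄ = refl

  rescale-injective : ∀ {g h} → rescale g ≡ rescale h → g ≡ h
  rescale-injective {g} {h} eq = begin
    g                   ≡⟨ sym (unscale∘rescale g) ⟩
    unscale (rescale g) ≡⟨ cong unscale eq ⟩
    unscale (rescale h) ≡⟨ unscale∘rescale h ⟩
    h                   ∎
    where open ≡-Reasoning

  rescale-sPoint : ∀ a x → rescale (sPoint a x) ≡ sPoint (a * α ⁻¹) (α * x)
  rescale-sPoint a x =
    cong₂ _,_ refl (cong₂ _,_ second (cong₂ _,_ third (cong₂ _,_ fourth fifth)))
    where
    u : Carrier
    u = α ⁻¹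
    second : x * a ≡ (α * x) * (a * u)
    second = sym (cancel-α*α⁻¹
      (solve 4 (λ A U X Y → (A :* X) :* (Y :* U) := (A :* U) :* (X :* Y)) refl α u x a))
    third : (x * (a * a)) * u ≡ (α * x) * ((a * u) * (a * u))
    third = sym (cancel-α*α⁻¹
      (solve 4 (λ A U X Y → (A :* X) :* ((Y :* U) :* (Y :* U))
                          := (A :* U) :* ((X :* (Y :* Y)) :* U)) refl α u x a))
    fourth : α * ((x * x) * a) ≡ ((α * x) * (α * x)) * (a * u)
    fourth = sym (cancel-α*α⁻¹
      (solve 4 (λ A U X Y → ((A :* X) :* (A :* X)) :* (Y :* U)
                          := (A :* U) :* (A :* ((X :* X) :* Y))) refl α u x a))
    fifth : (x * x) * (a * a) ≡ ((α * x) * (α * x)) * ((a * u) * (a * u))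
    fifth = sym (cancel-α*α⁻¹ (cancel-α*α⁻¹
      (solve 4 (λ A U X Y → ((A :* X) :* (A :* X)) :* ((Y :* U) :* (Y :* U))
                          := (A :* U) :* ((A :* U) :* ((X :* X) :* (Y :* Y)))) refl α u x a)))

  rescale-S↭S : map rescale S ↭ S
  rescale-S↭S = unique-⇔⇒↭ (Unique.map⁺ rescale-injective (S-unique F)) (S-unique F)
                           (mk⇔ rescaled∈S ∈rescaled)
    where
    rescaled∈S : ∀ {z} → z ∈ map rescale S → z ∈ S
    rescaled∈S z∈ with ∈-map⁻ rescale z∈
    ... | g , g∈S , refl with ∈S⇒sPoint F g∈S
    ... | a , x , x≢0 , refl rewrite rescale-sPoint a x = sPoint∈S F (a * α ⁻¹) (α*x≢0 x≢0)

    ∈rescaled : ∀ {z} → z ∈ S → z ∈ map rescale S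
    ∈rescaled z∈S with ∈S⇒sPoint F z∈S
    ... | a , x , x≢0 , refl =
      subst (_∈ map rescale S) preimage (∈-map⁺ rescale (sPoint∈S F (a * α) (α⁻¹*x≢0 x≢0)))
      where
      preimage : rescale (sPoint (a * α) (α ⁻¹ * x)) ≡ sPoint a x
      preimage = trans (rescale-sPoint (a * α) (α ⁻¹ * x)) (cong₂ sPoint ([x*α]*α⁻¹ a) (α*[α⁻¹*x] x))

  shift-rescale : ∀ x₁ → 2# * 1# * (α * x₁) ≡ 2# * α * x₁
  shift-rescale x₁ = trans (cong (_* (α * x₁)) (*-identityʳ 2#)) (sym (*-assoc 2# α x₁))

  phase-rescale : ∀ β γ x₂ x₃ x₄ x₅ j →
    (x₂ + (β / α) * x₃) * j + α * x₄ + β * x₅ + γ * x₃ ≡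
    (x₂ + (β / 1#) * (x₃ * α ⁻¹)) * j + 1# * (α * x₄) + β * x₅ + (α * γ) * (x₃ * α ⁻¹)
  phase-rescale β γ x₂ x₃ x₄ x₅ j rewrite 1⁻¹≡1 F = begin
    P + γ * x₃                 ≡⟨ cong (P +_) (sym (cancel-α*α⁻¹ refl)) ⟩
    P + (α * α ⁻¹) * (γ * x₃)  ≡⟨ solve 9 (λ A U B X₂ X₃ X₄ X₅ J Γ →
                                     (X₂ :+ (B :* U) :* X₃) :* J :+ A :* X₄ :+ B :* X₅ :+ (A :* U) :* (Γ :* X₃)
                                  := (X₂ :+ (B :* con 1) :* (X₃ :* U)) :* J :+ con 1 :* (A :* X₄)
                                       :+ B :* X₅ :+ (A :* Γ) :* (X₃ :* U))
                                  refl α (α ⁻¹) β x₂ x₃ x₄ x₅ j γ ⟩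
    (x₂ + (β * 1#) * (x₃ * α ⁻¹)) * j + 1# * (α * x₄) + β * x₅ + (α * γ) * (x₃ * α ⁻¹) ∎
    where
    open ≡-Reasoning
    P : Carrier
    P = (x₂ + (β / α) * x₃) * j + α * x₄ + β * x₅

  M-rescale : ∀ β γ g j k → M α β γ g j k ≡ M 1# β (α * γ) (rescale g) j k
  M-rescale β γ (x₁ , x₂ , x₃ , x₄ , x₅) j k
    with k ≟ (2# * α * x₁ + j) | k ≟ (2# * 1# * (α * x₁) + j)
  ... | yes _ | yes _ = cong (ζ^ ∘ trace) (phase-rescale β γ x₂ x₃ x₄ x₅ j)
  ... | no _  | no _  = refl
  ... | yes k≡ | no k≢ = ⊥-elim (k≢ (trans k≡ (cong (_+ j) (sym (shift-rescale x₁)))))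
  ... | no k≢ | yes k≡ = ⊥-elim (k≢ (trans k≡ (cong (_+ j) (shift-rescale x₁))))

  MS-rescale : ∀ β γ j k t → MS α β γ j k t ≡ MS 1# β (α * γ) j k t
  MS-rescale β γ j k t = begin
    MS α β γ j k t                                              ≡⟨ cong (λ us → sumζ us t)
                                                                     (List.map-cong (λ g → M-rescale β γ g j k) S) ⟩
    sumζ (map ((λ g → M 1# β (α * γ) g j k) ∘ rescale) S) t ≡⟨ sumζ-reindex _ rescale rescale-S↭S t ⟩
    MS 1# β (α * γ) j k t                                       ∎
    where open ≡-Reasoning

open FiniteField using (Carrier; q; 0#; 1#; _*_)
open Matrices using (MS)

lemma5p3 : (F : FiniteField) → ¬ (2 ∣ q F) →
    (α β γ : Carrier F) → α ≢ 0# F → β ≢ 0# F →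
    ∀ j k → MS F α β γ j k ≈ζ MS F (1# F) β (_*_ F α γ) j k
lemma5p3 F _ α β γ α≢0 _ j k =
  ℤ.0ℤ , λ t → trans (Rescaling.MS-rescale F α≢0 β γ j k t) (sym (ℤ.+-identityʳ _))
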